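{- Let $n\ge 1$, let $X$ be an $n\times n$ matrix with real (or rational) entries, let $s,t$ be scalars (or commuting indeterminates), and let $I$ denote the $n\times n$ identity matrix. Then for every $0\le \ell\le n$ and all $\ell$-subsets $\mathrm{S},\mathrm{T}\subseteq[n]$, $$\left((sI+tX)^{\vee\ell}\right)_{\mathrm{S}\mathrm{T}}=\sum_{0\le j\le \ell} s^{\ell-j}t^{j}\sum_{\substack{\mathrm{A}\subseteq \mathrm{S}\cap\mathrm{T}\\ |\mathrm{A}|=\ell-j}}\left(X^{\vee j}\right)_{\mathrm{S}\setminus\mathrm{A},\,\mathrm{T}\setminus\mathrm{A}}.$$
   Context: $[n]=\{1,\dots,n\}$. For an $n\times n$ matrix $Y$ and $0\le k\le n$, the $k$-th zeon power $Y^{\vee k}$ is the $\binom nk\times\binom nk$ matrix whose rows and columns are indexed by the $k$-subsets of $[n]$, with $(Y^{\vee k})_{\mathrm{B}\mathrm{C}}$ equal to the permanent of the $k\times k$ submatrix of $Y$ with row set $\mathrm{B}$ and column set $\mathrm{C}$ (rows and columns taken in increasing order). For $k=0$, $Y^{\vee 0}$ is the $1\times 1$ matrix with entry $1$ (indexed by the empty set). Equivalently, $Y^{\vee k}$ is the matrix of the action induced by $Y$ on the degree-$k$ part of the zeon algebra generated by commuting $e_1,\dots,e_n$ with $e_i^2=0$. -}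

module Defs where

open import Level using (Level)
open import Algebra.Bundles using (CommutativeRing)
open import Data.Nat using (ℕ; zero; suc; _∸_)
import Data.Nat as ℕ
open import Data.Fin using (Fin; zero; suc; cast)
import Data.Fin as F
import Data.Fin.Properties as FP
open import Data.Fin.Subset using (Subset; ∣_∣; _∩_; _─_; _⊆_; inside; outside)
open import Data.Fin.Subset.Properties using (_⊆?_)
open import Data.Vec using (Vec; []; _∷_; toList)
import Data.Vec as V
open import Data.List using (List; []; _∷_; map; filter; concatMap; foldr; upTo; length; lookup; allFin)
import Data.List as L
open import Data.Bool using (Bool; true; false)
open import Data.Product using (_×_; _,_)
open import Relation.Nullary using (yes; no)
open import Relation.Nullary.Decidable using (_×-dec_)
open import Relation.Binary.PropositionalEquality using (_≡_; refl; sym)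
import Data.List.Relation.Unary.Unique.DecSetoid as UDS

allVecs : (k m : ℕ) → List (Vec (Fin m) k)
allVecs zero    m = [] ∷ []
allVecs (suc k) m = concatMap (λ i → map (i ∷_) (allVecs k m)) (allFin m)

-- All permutations σ of Fin k, encoded as the vector (σ 0, …, σ (k-1)):
-- exactly the maps Fin k → Fin k with pairwise distinct values.
permutations : (k : ℕ) → List (Vec (Fin k) k)
permutations k = filter (λ v → UDS.unique? (FP.≡-decSetoid k) (toList v)) (allVecs k k)

allSubsets : (n : ℕ) → List (Subset n)
allSubsets zero    = [] ∷ []
allSubsets (suc n) = concatMap (λ b → map (b ∷_) (allSubsets n)) (outside ∷ inside ∷ [])

elems : {n : ℕ} → Subset n → List (Fin n)
elems []            = []
elems (outside ∷ p) = map suc (elems p)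
elems (inside ∷ p)  = zero ∷ map suc (elems p)

module _ {c ℓ : Level} (R : CommutativeRing c ℓ) where
  open CommutativeRing R using (Carrier; _+_; _*_; 0#; 1#)

  Matrix : ℕ → Set c
  Matrix n = Fin n → Fin n → Carrier

  ΣL : List Carrier → Carrier
  ΣL = foldr _+_ 0#

  ΠF : (k : ℕ) → (Fin k → Carrier) → Carrier
  ΠF zero    f = 1#
  ΠF (suc k) f = f zero * ΠF k (λ i → f (suc i))

  pow : Carrier → ℕ → Carrier
  pow x zero    = 1#
  pow x (suc m) = x * pow x m

  permanent : (k : ℕ) → (Fin k → Fin k → Carrier) → Carrier
  permanent k M = ΣL (map (λ σ → ΠF k (λ i → M i (V.lookup σ i))) (permutations k))

  -- Entry (Y^∨k)_{B C} of the k-th zeon power: the permanent of the submatrix of Y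
  -- with row set B and column set C (taken in increasing order), when |B| = |C| = k.
  -- (Pairs (B , C) that are not k-subsets are not indices of Y^∨k; we set 0 there.)
  zeon : {n : ℕ} → Matrix n → (k : ℕ) → Subset n → Subset n → Carrier
  zeon Y k B C with length (elems B) ℕ.≟ k | length (elems C) ℕ.≟ k
  ... | yes p | yes q = permanent k (λ i j → Y (lookup (elems B) (cast (sym p) i))
                                                (lookup (elems C) (cast (sym q) j)))
  ... | _     | _     = 0#

  idM : {n : ℕ} → Matrix n
  idM i j with i F.≟ j
  ... | yes _ = 1#
  ... | no  _ = 0#

  sI+tX : {n : ℕ} → Carrier → Carrier → Matrix n → Matrix n
  sI+tX s t X i j = (s * idM i j) + (t * X i j)

  rhs : {n : ℕ} → Carrier → Carrier → Matrix n → (l : ℕ) → Subset n → Subset n → Carrier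
  rhs {n} s t X l S T =
    ΣL (map (λ j → (pow s (l ∸ j) * pow t j) *
                   ΣL (map (λ A → zeon X j (S ─ A) (T ─ A))
                           (filter (λ A → (A ⊆? (S ∩ T)) ×-dec (∣ A ∣ ℕ.≟ l ∸ j)) (allSubsets n))))
            (upTo (suc l)))

-- Expanding a permanent of sI + tX row by row, each row r either takes the diagonal part
-- s·δ(r,c), which forces it onto its own column, or some entry t·X r c.  Grouping the terms by
-- the set A of rows of the first kind (necessarily A ⊆ S ∩ T) leaves s^|A| t^(ℓ−|A|) times a
-- permanent of X with rows S ∖ A and columns T ∖ A.  To make this an induction, the permanent
-- is computed along the rows while recording the set D of columns still free; the sum over A
-- then satisfies the same first-row recursion, according as the first row lies in A or not.

module Submission where

open import Level using (Level)
open import Algebra.Bundles using (CommutativeRing)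
open import Data.Bool using (Bool; true; false; _∧_; _∨_; not; if_then_else_)
open import Data.Bool.Properties using (∧-zeroʳ; ∧-identityʳ; ∧-assoc; not-injective)
open import Data.Bool.Solver using (module ∨-∧-Solver)
open import Data.Empty using (⊥-elim)
open import Data.Fin as F using (Fin; zero; suc; cast)
import Data.Fin.Properties as FP
open import Data.Fin.Subset using (Subset; ∣_∣; _∩_; _∪_; _─_; _⊆_; ⁅_⁆; ⊥; inside; outside)
open import Data.Fin.Subset.Properties
  using (_⊆?_; p⊆q⇒∣p∣≤∣q∣; ∪-identityˡ; p─⊥≡p; p─q─r≡p─q∪r; p─q─r≡p─r─q; ∣⊥∣≡0)
open import Data.List as L using (List; []; _∷_; map; length; allFin; tabulate; upTo)
import Data.List.Properties as LP
import Data.List.Relation.Unary.All as All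
import Data.List.Relation.Unary.Unique.DecSetoid as UDS
open import Data.Nat as ℕ using (ℕ; zero; suc; _∸_; _≤_)
import Data.Nat.Properties as NP
open import Data.Product using (_×_; _,_; proj₁; proj₂)
open import Data.Unit using (⊤; tt)
open import Data.Vec as V using (Vec; []; _∷_; lookup)
import Data.Vec.Properties as VP
open import Function using (_∘_)
open import Function.Definitions using (Injective)
open import Relation.Nullary using (Dec; yes; no; does)
open import Relation.Unary using (Decidable)
open import Relation.Nullary.Decidable using (dec-true; dec-false; ¬?; _×-dec_)
open import Relation.Binary.PropositionalEquality
  using (_≡_; _≢_; refl; sym; trans; cong; cong₂; subst; module ≡-Reasoning)

open import Defs

private
  variable
    n : ℕ

bool-ext : {a b : Bool} → (a ≡ true → b ≡ true) → (b ≡ true → a ≡ true) → a ≡ b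
bool-ext {true}  {true}  f g = refl
bool-ext {true}  {false} f g = sym (f refl)
bool-ext {false} {true}  f g = g refl
bool-ext {false} {false} f g = refl

∧-true⁻ : {a b : Bool} → a ∧ b ≡ true → a ≡ true × b ≡ true
∧-true⁻ {true} {true} refl = refl , refl

∨-true⁺ʳ : (a : Bool) {b : Bool} → b ≡ true → a ∨ b ≡ true
∨-true⁺ʳ true  e = refl
∨-true⁺ʳ false e = e

not-∨ : ∀ a b → not (a ∨ b) ≡ not a ∧ not b
not-∨ true  b = refl
not-∨ false b = refl

does-true⇒ : {P : Set} (P? : Dec P) → does P? ≡ true → P
does-true⇒ (yes p) _ = p

_==_ : Fin n → Fin n → Bool
i == j = does (i F.≟ j)

==-refl : (i : Fin n) → (i == i) ≡ true
==-refl i = dec-true (i F.≟ i) refl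

==⇒≡ : {i j : Fin n} → (i == j) ≡ true → i ≡ j
==⇒≡ {i = i} {j} = does-true⇒ (i F.≟ j)

≢⇒==-false : {i j : Fin n} → i ≢ j → (i == j) ≡ false
≢⇒==-false {i = i} {j} = dec-false (i F.≟ j)

_∈ᵇ_ : Fin n → List (Fin n) → Bool
x ∈ᵇ []       = false
x ∈ᵇ (y ∷ ys) = (x == y) ∨ (x ∈ᵇ ys)

Distinct : List (Fin n) → Set
Distinct []       = ⊤
Distinct (x ∷ xs) = (x ∈ᵇ xs) ≡ false × Distinct xs

fromList : List (Fin n) → Subset n
fromList xs = V.tabulate (_∈ᵇ xs)

remove : Subset n → List (Fin n) → List (Fin n)
remove A []       = []
remove A (x ∷ xs) = if lookup A x then remove A xs else x ∷ remove A xs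

∈ᵇ-≢ : {x r : Fin n} (rs : List (Fin n)) → (r ∈ᵇ rs) ≡ false → (x ∈ᵇ rs) ≡ true → x ≢ r
∈ᵇ-≢ rs r∉ x∈ refl with trans (sym r∉) x∈
... | ()

∈ᵇ-lookup : (xs : List (Fin n)) (i : Fin (length xs)) → (L.lookup xs i ∈ᵇ xs) ≡ true
∈ᵇ-lookup (x ∷ xs) zero    = cong (_∨ (x ∈ᵇ xs)) (==-refl x)
∈ᵇ-lookup (x ∷ xs) (suc i) = ∨-true⁺ʳ _ (∈ᵇ-lookup xs i)

lookup-injective : (xs : List (Fin n)) → Distinct xs → (i j : Fin (length xs)) →
                   L.lookup xs i ≡ L.lookup xs j → i ≡ j
lookup-injective (x ∷ xs) d       zero    zero    e = refl
lookup-injective (x ∷ xs) (x∉ , d) zero    (suc j) e = ⊥-elim (∈ᵇ-≢ xs x∉ (∈ᵇ-lookup xs j) (sym e))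
lookup-injective (x ∷ xs) (x∉ , d) (suc i) zero    e = ⊥-elim (∈ᵇ-≢ xs x∉ (∈ᵇ-lookup xs i) e)
lookup-injective (x ∷ xs) (x∉ , d) (suc i) (suc j) e = cong suc (lookup-injective xs d i j e)

subset-ext : {A B : Subset n} → (∀ i → lookup A i ≡ lookup B i) → A ≡ B
subset-ext {A = A} {B} e =
  trans (sym (VP.tabulate∘lookup A)) (trans (VP.tabulate-cong e) (VP.tabulate∘lookup B))

lookup-∩ : (A B : Subset n) (i : Fin n) → lookup (A ∩ B) i ≡ lookup A i ∧ lookup B i
lookup-∩ A B i = VP.lookup-zipWith _∧_ i A B

lookup-∪ : (A B : Subset n) (i : Fin n) → lookup (A ∪ B) i ≡ lookup A i ∨ lookup B i
lookup-∪ A B i = VP.lookup-zipWith _∨_ i A B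

lookup-─ : (A B : Subset n) (i : Fin n) → lookup (A ─ B) i ≡ lookup A i ∧ not (lookup B i)
lookup-─ (a ∷ A) (inside  ∷ B) zero    = sym (∧-zeroʳ a)
lookup-─ (a ∷ A) (outside ∷ B) zero    = sym (∧-identityʳ a)
lookup-─ (a ∷ A) (b ∷ B)       (suc i) = lookup-─ A B i

lookup-⁅⁆ : (c i : Fin n) → lookup ⁅ c ⁆ i ≡ (i == c)
lookup-⁅⁆ zero    zero    = refl
lookup-⁅⁆ zero    (suc i) = VP.lookup-replicate i outside
lookup-⁅⁆ (suc c) zero    = refl
lookup-⁅⁆ (suc c) (suc i) = lookup-⁅⁆ c i

lookup-fromList : (xs : List (Fin n)) (i : Fin n) → lookup (fromList xs) i ≡ (i ∈ᵇ xs)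
lookup-fromList xs = VP.lookup∘tabulate (_∈ᵇ xs)

lookup-fromList-∩ : (xs : List (Fin n)) (D : Subset n) (i : Fin n) →
                    lookup (fromList xs ∩ D) i ≡ (i ∈ᵇ xs) ∧ lookup D i
lookup-fromList-∩ xs D i = trans (lookup-∩ (fromList xs) D i) (cong (_∧ lookup D i) (lookup-fromList xs i))

lookup-⁅⁆∪ : (r : Fin n) (A : Subset n) (i : Fin n) → lookup (⁅ r ⁆ ∪ A) i ≡ (i == r) ∨ lookup A i
lookup-⁅⁆∪ r A i = trans (lookup-∪ ⁅ r ⁆ A i) (cong (_∨ lookup A i) (lookup-⁅⁆ r i))

lookup-⁅⁆∪-self : (r : Fin n) (A : Subset n) → lookup (⁅ r ⁆ ∪ A) r ≡ true
lookup-⁅⁆∪-self r A = trans (lookup-⁅⁆∪ r A r) (cong (_∨ lookup A r) (==-refl r))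

∣⁅⁆∪∣ : (r : Fin n) (A : Subset n) → lookup A r ≡ false → ∣ ⁅ r ⁆ ∪ A ∣ ≡ suc ∣ A ∣
∣⁅⁆∪∣ zero    (outside ∷ A) e = cong suc (cong ∣_∣ (∪-identityˡ A))
∣⁅⁆∪∣ (suc r) (outside ∷ A) e = ∣⁅⁆∪∣ r A e
∣⁅⁆∪∣ (suc r) (inside  ∷ A) e = cong suc (∣⁅⁆∪∣ r A e)

∩-─ : (X D E : Subset n) → X ∩ (D ─ E) ≡ (X ∩ D) ─ E
∩-─ X D E = subset-ext λ i → begin
  lookup (X ∩ (D ─ E)) i                 ≡⟨ trans (lookup-∩ X (D ─ E) i) (cong (x i ∧_) (lookup-─ D E i)) ⟩
  x i ∧ (lookup D i ∧ not (lookup E i))  ≡⟨ sym (∧-assoc (x i) _ _) ⟩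
  (x i ∧ lookup D i) ∧ not (lookup E i)  ≡⟨ sym (trans (lookup-─ (X ∩ D) E i) (cong (_∧ _) (lookup-∩ X D i))) ⟩
  lookup ((X ∩ D) ─ E) i                 ∎
  where
  open ≡-Reasoning
  x = lookup X

_⊆ᵇ_ : Subset n → Subset n → Bool
A ⊆ᵇ B = does (A ⊆? B)

⊆ᵇ-lookup : (A B : Subset n) → (A ⊆ᵇ B) ≡ true → ∀ i → lookup A i ≡ true → lookup B i ≡ true
⊆ᵇ-lookup (inside  ∷ A) (inside  ∷ B) e zero    a = refl
⊆ᵇ-lookup (outside ∷ A) (b       ∷ B) e zero    ()
⊆ᵇ-lookup (inside  ∷ A) (outside ∷ B) () i
⊆ᵇ-lookup (outside ∷ A) (b       ∷ B) e (suc i) a = ⊆ᵇ-lookup A B e i a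
⊆ᵇ-lookup (inside  ∷ A) (inside  ∷ B) e (suc i) a = ⊆ᵇ-lookup A B e i a

⊆ᵇ-∩⁻ : (A S T : Subset n) → (A ⊆ᵇ (S ∩ T)) ≡ true → (A ⊆ᵇ S) ≡ true × (A ⊆ᵇ T) ≡ true
⊆ᵇ-∩⁻ []            []            []            e = refl , refl
⊆ᵇ-∩⁻ (outside ∷ A) (s       ∷ S) (t       ∷ T) e = ⊆ᵇ-∩⁻ A S T e
⊆ᵇ-∩⁻ (inside  ∷ A) (inside  ∷ S) (inside  ∷ T) e = ⊆ᵇ-∩⁻ A S T e
⊆ᵇ-∩⁻ (inside  ∷ A) (outside ∷ S) (t       ∷ T) ()
⊆ᵇ-∩⁻ (inside  ∷ A) (inside  ∷ S) (outside ∷ T) ()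

⊆ᵇ-cong : (A X Y : Subset n) → (∀ i → lookup A i ≡ true → lookup X i ≡ lookup Y i) →
          (A ⊆ᵇ X) ≡ (A ⊆ᵇ Y)
⊆ᵇ-cong []            []            []            h = refl
⊆ᵇ-cong (outside ∷ A) (x       ∷ X) (y       ∷ Y) h = ⊆ᵇ-cong A X Y (h ∘ suc)
⊆ᵇ-cong (inside  ∷ A) (outside ∷ X) (outside ∷ Y) h = refl
⊆ᵇ-cong (inside  ∷ A) (inside  ∷ X) (inside  ∷ Y) h = ⊆ᵇ-cong A X Y (h ∘ suc)
⊆ᵇ-cong (inside  ∷ A) (outside ∷ X) (inside  ∷ Y) h with () ← h zero refl
⊆ᵇ-cong (inside  ∷ A) (inside  ∷ X) (outside ∷ Y) h with () ← h zero refl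

⊆ᵇ-absorb : (A X : Subset n) (r : Fin n) → lookup X r ≡ false →
            (A ⊆ᵇ X) ≡ not (lookup A r) ∧ (A ⊆ᵇ X)
⊆ᵇ-absorb A X r X∌r with lookup A r in A∋r | A ⊆ᵇ X in A⊆X
... | false | _     = refl
... | true  | false = refl
... | true  | true  with () ← trans (sym (⊆ᵇ-lookup A X A⊆X r A∋r)) X∌r

⊆ᵇ-⁅⁆∪ : (r : Fin n) (A X : Subset n) → ((⁅ r ⁆ ∪ A) ⊆ᵇ X) ≡ lookup X r ∧ (A ⊆ᵇ X)
⊆ᵇ-⁅⁆∪ zero    (a       ∷ A) (outside ∷ X) = refl
⊆ᵇ-⁅⁆∪ zero    (outside ∷ A) (inside  ∷ X) = cong (_⊆ᵇ X) (∪-identityˡ A)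
⊆ᵇ-⁅⁆∪ zero    (inside  ∷ A) (inside  ∷ X) = cong (_⊆ᵇ X) (∪-identityˡ A)
⊆ᵇ-⁅⁆∪ (suc r) (outside ∷ A) (x       ∷ X) = ⊆ᵇ-⁅⁆∪ r A X
⊆ᵇ-⁅⁆∪ (suc r) (inside  ∷ A) (outside ∷ X) = sym (∧-zeroʳ _)
⊆ᵇ-⁅⁆∪ (suc r) (inside  ∷ A) (inside  ∷ X) = ⊆ᵇ-⁅⁆∪ r A X

⊆ᵇ-─⁅⁆ : (A X : Subset n) (r : Fin n) → (A ⊆ᵇ (X ─ ⁅ r ⁆)) ≡ not (lookup A r) ∧ (A ⊆ᵇ X)
⊆ᵇ-─⁅⁆ (outside ∷ A) (x       ∷ X) zero    = cong (A ⊆ᵇ_) (p─⊥≡p X)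
⊆ᵇ-─⁅⁆ (inside  ∷ A) (x       ∷ X) zero    = refl
⊆ᵇ-─⁅⁆ (outside ∷ A) (x       ∷ X) (suc r) = ⊆ᵇ-─⁅⁆ A X r
⊆ᵇ-─⁅⁆ (inside  ∷ A) (outside ∷ X) (suc r) = sym (∧-zeroʳ _)
⊆ᵇ-─⁅⁆ (inside  ∷ A) (inside  ∷ X) (suc r) = ⊆ᵇ-─⁅⁆ A X r

admissible : List (Fin n) → Subset n → Subset n → Bool
admissible rs D A = A ⊆ᵇ (fromList rs ∩ D)

admissible-∷ : (r : Fin n) (rs : List (Fin n)) (D A : Subset n) →
               not (lookup A r) ∧ admissible (r ∷ rs) D A ≡ not (lookup A r) ∧ admissible rs D A
admissible-∷ r rs D A with lookup A r in A∌r
... | true  = refl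
... | false = ⊆ᵇ-cong A (fromList (r ∷ rs) ∩ D) (fromList rs ∩ D) agree
  where
  agree : ∀ i → lookup A i ≡ true → lookup (fromList (r ∷ rs) ∩ D) i ≡ lookup (fromList rs ∩ D) i
  agree i A∋i = begin
    lookup (fromList (r ∷ rs) ∩ D) i     ≡⟨ lookup-fromList-∩ (r ∷ rs) D i ⟩
    ((i == r) ∨ (i ∈ᵇ rs)) ∧ lookup D i  ≡⟨ cong (λ q → (q ∨ (i ∈ᵇ rs)) ∧ lookup D i) (≢⇒==-false i≢r) ⟩
    (i ∈ᵇ rs) ∧ lookup D i               ≡⟨ lookup-fromList-∩ rs D i ⟨
    lookup (fromList rs ∩ D) i           ∎
    where
    open ≡-Reasoning
    i≢r : i ≢ r
    i≢r refl with () ← trans (sym A∋i) A∌r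

admissible-insert : (r : Fin n) (rs : List (Fin n)) (D A : Subset n) →
                    not (lookup A r) ∧ admissible (r ∷ rs) D (⁅ r ⁆ ∪ A)
                    ≡ lookup D r ∧ admissible rs (D ─ ⁅ r ⁆) A
admissible-insert r rs D A = begin
  a ∧ ((⁅ r ⁆ ∪ A) ⊆ᵇ E)                  ≡⟨ cong (a ∧_) (⊆ᵇ-⁅⁆∪ r A E) ⟩
  a ∧ (lookup E r ∧ (A ⊆ᵇ E))             ≡⟨ cong (λ e → a ∧ (e ∧ (A ⊆ᵇ E))) E∋r ⟩
  a ∧ (d ∧ (A ⊆ᵇ E))                      ≡⟨ swap a d (A ⊆ᵇ E) ⟩
  d ∧ (a ∧ admissible (r ∷ rs) D A)       ≡⟨ cong (d ∧_) (admissible-∷ r rs D A) ⟩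
  d ∧ (a ∧ (A ⊆ᵇ (fromList rs ∩ D)))      ≡⟨ cong (d ∧_) (⊆ᵇ-─⁅⁆ A (fromList rs ∩ D) r) ⟨
  d ∧ (A ⊆ᵇ ((fromList rs ∩ D) ─ ⁅ r ⁆))  ≡⟨ cong (λ X → d ∧ (A ⊆ᵇ X)) (∩-─ (fromList rs) D ⁅ r ⁆) ⟨
  d ∧ admissible rs (D ─ ⁅ r ⁆) A         ∎
  where
  open ≡-Reasoning
  open ∨-∧-Solver
  a = not (lookup A r)
  d = lookup D r
  E = fromList (r ∷ rs) ∩ D
  E∋r : lookup E r ≡ d
  E∋r = trans (lookup-fromList-∩ (r ∷ rs) D r) (cong (λ q → (q ∨ (r ∈ᵇ rs)) ∧ d) (==-refl r))
  swap : ∀ x y z → x ∧ (y ∧ z) ≡ y ∧ (x ∧ z)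
  swap = solve 3 (λ x y z → x :* (y :* z) := y :* (x :* z)) refl

admissible-skip : (r : Fin n) (rs : List (Fin n)) → (r ∈ᵇ rs) ≡ false → (D A : Subset n) (c : Fin n) →
                  not (lookup A r) ∧ (admissible (r ∷ rs) D A ∧ lookup (D ─ A) c)
                  ≡ lookup D c ∧ admissible rs (D ─ ⁅ c ⁆) A
admissible-skip r rs r∉rs D A c = begin
  a ∧ (admissible (r ∷ rs) D A ∧ lookup (D ─ A) c)  ≡⟨ cong (λ x → a ∧ (admissible (r ∷ rs) D A ∧ x)) (lookup-─ D A c) ⟩
  a ∧ (admissible (r ∷ rs) D A ∧ (d ∧ b))           ≡⟨ sym (∧-assoc a _ _) ⟩
  (a ∧ admissible (r ∷ rs) D A) ∧ (d ∧ b)           ≡⟨ cong (_∧ (d ∧ b)) (admissible-∷ r rs D A) ⟩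
  (a ∧ S) ∧ (d ∧ b)                                 ≡⟨ rearrange a S d b ⟩
  d ∧ (b ∧ (a ∧ S))                                 ≡⟨ cong (λ x → d ∧ (b ∧ x)) (⊆ᵇ-absorb A (fromList rs ∩ D) r E∌r) ⟨
  d ∧ (b ∧ S)                                       ≡⟨ cong (d ∧_) (⊆ᵇ-─⁅⁆ A (fromList rs ∩ D) c) ⟨
  d ∧ (A ⊆ᵇ ((fromList rs ∩ D) ─ ⁅ c ⁆))            ≡⟨ cong (λ X → d ∧ (A ⊆ᵇ X)) (∩-─ (fromList rs) D ⁅ c ⁆) ⟨
  d ∧ admissible rs (D ─ ⁅ c ⁆) A                   ∎
  where
  open ≡-Reasoning
  open ∨-∧-Solver
  a = not (lookup A r)
  b = not (lookup A c)
  d = lookup D c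
  S = admissible rs D A
  E∌r : lookup (fromList rs ∩ D) r ≡ false
  E∌r = trans (lookup-fromList-∩ rs D r) (cong (_∧ lookup D r) r∉rs)
  rearrange : ∀ w x y z → (w ∧ x) ∧ (y ∧ z) ≡ y ∧ (z ∧ (w ∧ x))
  rearrange = solve 4 (λ w x y z → (w :* x) :* (y :* z) := y :* (z :* (w :* x))) refl

∈ᵇ-map-suc : (x : Fin n) (xs : List (Fin n)) → (suc x ∈ᵇ map suc xs) ≡ (x ∈ᵇ xs)
∈ᵇ-map-suc x []       = refl
∈ᵇ-map-suc x (y ∷ ys) = cong ((x == y) ∨_) (∈ᵇ-map-suc x ys)

zero-∉ᵇ-map-suc : (xs : List (Fin n)) → (zero ∈ᵇ map suc xs) ≡ false
zero-∉ᵇ-map-suc []       = refl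
zero-∉ᵇ-map-suc (y ∷ ys) = zero-∉ᵇ-map-suc ys

Distinct-map-suc : (xs : List (Fin n)) → Distinct xs → Distinct (map suc xs)
Distinct-map-suc []       d        = tt
Distinct-map-suc (x ∷ xs) (x∉ , d) = trans (∈ᵇ-map-suc x xs) x∉ , Distinct-map-suc xs d

Distinct-elems : (S : Subset n) → Distinct (elems S)
Distinct-elems []            = tt
Distinct-elems (outside ∷ S) = Distinct-map-suc (elems S) (Distinct-elems S)
Distinct-elems (inside  ∷ S) = zero-∉ᵇ-map-suc (elems S) , Distinct-map-suc (elems S) (Distinct-elems S)

∈ᵇ-elems : (S : Subset n) (i : Fin n) → (i ∈ᵇ elems S) ≡ lookup S i
∈ᵇ-elems (outside ∷ S) zero    = zero-∉ᵇ-map-suc (elems S)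
∈ᵇ-elems (inside  ∷ S) zero    = refl
∈ᵇ-elems (outside ∷ S) (suc i) = trans (∈ᵇ-map-suc i (elems S)) (∈ᵇ-elems S i)
∈ᵇ-elems (inside  ∷ S) (suc i) = trans (∈ᵇ-map-suc i (elems S)) (∈ᵇ-elems S i)

fromList-elems : (S : Subset n) → fromList (elems S) ≡ S
fromList-elems S = subset-ext λ i → trans (lookup-fromList (elems S) i) (∈ᵇ-elems S i)

lookup-elems : (S : Subset n) (i : Fin (length (elems S))) → lookup S (L.lookup (elems S) i) ≡ true
lookup-elems S i = trans (sym (∈ᵇ-elems S _)) (∈ᵇ-lookup (elems S) i)

length-elems : (S : Subset n) → length (elems S) ≡ ∣ S ∣
length-elems []            = refl
length-elems (outside ∷ S) = trans (LP.length-map suc (elems S)) (length-elems S)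
length-elems (inside  ∷ S) = cong suc (trans (LP.length-map suc (elems S)) (length-elems S))

∣─∣+∣∣ : (S A : Subset n) → (A ⊆ᵇ S) ≡ true → ∣ S ─ A ∣ ℕ.+ ∣ A ∣ ≡ ∣ S ∣
∣─∣+∣∣ []            []            e  = refl
∣─∣+∣∣ (outside ∷ S) (outside ∷ A) e  = ∣─∣+∣∣ S A e
∣─∣+∣∣ (inside  ∷ S) (outside ∷ A) e  = cong suc (∣─∣+∣∣ S A e)
∣─∣+∣∣ (inside  ∷ S) (inside  ∷ A) e  = trans (NP.+-suc ∣ S ─ A ∣ ∣ A ∣) (cong suc (∣─∣+∣∣ S A e))
∣─∣+∣∣ (outside ∷ S) (inside  ∷ A) ()

∣─∣≡∸ : (Z A : Subset n) {l : ℕ} → ∣ Z ∣ ≡ l → (A ⊆ᵇ Z) ≡ true → ∣ Z ─ A ∣ ≡ l ∸ ∣ A ∣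
∣─∣≡∸ Z A ∣Z∣≡l A⊆Z =
  trans (sym (NP.m+n∸n≡m ∣ Z ─ A ∣ ∣ A ∣)) (cong (_∸ ∣ A ∣) (trans (∣─∣+∣∣ Z A A⊆Z) ∣Z∣≡l))

remove-cong : (A B : Subset n) (rs : List (Fin n)) →
              (∀ x → (x ∈ᵇ rs) ≡ true → lookup A x ≡ lookup B x) → remove A rs ≡ remove B rs
remove-cong A B []       h = refl
remove-cong A B (x ∷ rs) h
  rewrite h x (cong (_∨ (x ∈ᵇ rs)) (==-refl x))
        | remove-cong A B rs (λ y y∈ → h y (∨-true⁺ʳ (y == x) y∈)) = refl

remove-⁅⁆∪ : (r : Fin n) (rs : List (Fin n)) (A : Subset n) → (r ∈ᵇ rs) ≡ false →
             remove (⁅ r ⁆ ∪ A) (r ∷ rs) ≡ remove A rs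
remove-⁅⁆∪ r rs A r∉rs rewrite lookup-⁅⁆∪-self r A = remove-cong (⁅ r ⁆ ∪ A) A rs λ x x∈rs →
  trans (lookup-⁅⁆∪ r A x) (cong (_∨ lookup A x) (≢⇒==-false (∈ᵇ-≢ rs r∉rs x∈rs)))

remove-map-suc : (a : Bool) (A : Subset n) (xs : List (Fin n)) → remove (a ∷ A) (map suc xs) ≡ map suc (remove A xs)
remove-map-suc a A []       = refl
remove-map-suc a A (x ∷ xs) with lookup A x
... | true  = remove-map-suc a A xs
... | false = cong (suc x ∷_) (remove-map-suc a A xs)

remove-elems : (S A : Subset n) → remove A (elems S) ≡ elems (S ─ A)
remove-elems []            []            = refl
remove-elems (outside ∷ S) (outside ∷ A) = trans (remove-map-suc outside A (elems S)) (cong (map suc) (remove-elems S A))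
remove-elems (outside ∷ S) (inside  ∷ A) = trans (remove-map-suc inside A (elems S)) (cong (map suc) (remove-elems S A))
remove-elems (inside  ∷ S) (inside  ∷ A) = trans (remove-map-suc inside A (elems S)) (cong (map suc) (remove-elems S A))
remove-elems (inside  ∷ S) (outside ∷ A) =
  cong (zero ∷_) (trans (remove-map-suc outside A (elems S)) (cong (map suc) (remove-elems S A)))

uniqueᵇ : List (Fin n) → Bool
uniqueᵇ {n} xs = does (UDS.unique? (FP.≡-decSetoid n) xs)

uniqueᵇ-∷ : (j : Fin n) (xs : List (Fin n)) → uniqueᵇ (j ∷ xs) ≡ not (j ∈ᵇ xs) ∧ uniqueᵇ xs
uniqueᵇ-∷ j xs = cong (_∧ _) (j-fresh xs)
  where
  j-fresh : ∀ xs → does (All.all? (λ y → ¬? (j F.≟ y)) xs) ≡ not (j ∈ᵇ xs)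
  j-fresh []       = refl
  j-fresh (y ∷ ys) = trans (cong (not (j == y) ∧_) (j-fresh ys)) (sym (not-∨ (j == y) (j ∈ᵇ ys)))

mapsInto : {m k : ℕ} → Subset n → (Fin m → Fin n) → Vec (Fin m) k → Bool
mapsInto D κ []      = true
mapsInto D κ (j ∷ v) = lookup D (κ j) ∧ mapsInto D κ v

mapsInto-─⁅⁆ : {m k : ℕ} (D : Subset n) (κ : Fin m → Fin n) → Injective _≡_ _≡_ κ → (j : Fin m) (v : Vec (Fin m) k) →
               mapsInto (D ─ ⁅ κ j ⁆) κ v ≡ mapsInto D κ v ∧ not (j ∈ᵇ V.toList v)
mapsInto-─⁅⁆ D κ κ-inj j []      = refl
mapsInto-─⁅⁆ D κ κ-inj j (i ∷ v) = begin
  lookup (D ─ ⁅ κ j ⁆) (κ i) ∧ mapsInto (D ─ ⁅ κ j ⁆) κ v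
    ≡⟨ cong₂ _∧_ (trans (lookup-─ D ⁅ κ j ⁆ (κ i)) (cong (λ q → d ∧ not q) κ-eq)) (mapsInto-─⁅⁆ D κ κ-inj j v) ⟩
  (d ∧ not (j == i)) ∧ (a ∧ not m)  ≡⟨ rearrange d (not (j == i)) a (not m) ⟩
  (d ∧ a) ∧ (not (j == i) ∧ not m)  ≡⟨ cong ((d ∧ a) ∧_) (not-∨ (j == i) m) ⟨
  (d ∧ a) ∧ not ((j == i) ∨ m)      ∎
  where
  open ≡-Reasoning
  open ∨-∧-Solver
  d = lookup D (κ i)
  a = mapsInto D κ v
  m = j ∈ᵇ V.toList v
  κ-eq : lookup ⁅ κ j ⁆ (κ i) ≡ (j == i)
  κ-eq = trans (lookup-⁅⁆ (κ j) (κ i))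
           (bool-ext (λ e → dec-true (j F.≟ i) (sym (κ-inj (==⇒≡ e))))
                     (λ e → dec-true (κ i F.≟ κ j) (cong κ (sym (==⇒≡ e)))))
  rearrange : ∀ w x y z → (w ∧ x) ∧ (y ∧ z) ≡ (w ∧ y) ∧ (x ∧ z)
  rearrange = solve 4 (λ w x y z → (w :* x) :* (y :* z) := (w :* y) :* (x :* z)) refl

mapsInto-true : {m k : ℕ} (D : Subset n) (κ : Fin m → Fin n) → (∀ j → lookup D (κ j) ≡ true) →
                (v : Vec (Fin m) k) → mapsInto D κ v ≡ true
mapsInto-true D κ h []      = refl
mapsInto-true D κ h (j ∷ v) = cong₂ _∧_ (h j) (mapsInto-true D κ h v)

tabulate-lookup-cast : (xs : List (Fin n)) (k : ℕ) (e : k ≡ length xs) → tabulate (L.lookup xs ∘ cast e) ≡ xs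
tabulate-lookup-cast []       zero    e = refl
tabulate-lookup-cast (x ∷ xs) (suc k) e = cong (x ∷_) (tabulate-lookup-cast xs k (NP.suc-injective e))

module _ {c ℓ : Level} (R : CommutativeRing c ℓ) where

  open CommutativeRing R hiding (zero; refl; sym; trans)
  open CommutativeRing R using () renaming (refl to ≈-refl; sym to ≈-sym; trans to ≈-trans)
  open import Relation.Binary.Reasoning.Setoid setoid
  open import Algebra.Properties.CommutativeSemigroup +-commutativeSemigroup using (interchange)
  open import Algebra.Properties.CommutativeSemigroup *-commutativeSemigroup using (x∙yz≈y∙xz)

  ∑ : {A : Set} → List A → (A → Carrier) → Carrier
  ∑ xs f = ΣL R (map f xs)

  syntax ∑ xs (λ x → e) = ∑[ x ∈ xs ] e

  [_]? : Bool → Carrier → Carrier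
  [ true  ]? x = x
  [ false ]? x = 0#

  ∑-cong : {A : Set} (xs : List A) {f g : A → Carrier} → (∀ x → f x ≈ g x) → ∑ xs f ≈ ∑ xs g
  ∑-cong []       e = ≈-refl
  ∑-cong (x ∷ xs) e = +-cong (e x) (∑-cong xs e)

  ∑-0# : {A : Set} (xs : List A) → ∑[ x ∈ xs ] 0# ≈ 0#
  ∑-0# []       = ≈-refl
  ∑-0# (x ∷ xs) = ≈-trans (+-identityˡ _) (∑-0# xs)

  ∑-distrib-+ : {A : Set} (xs : List A) (f g : A → Carrier) → ∑[ x ∈ xs ] (f x + g x) ≈ ∑ xs f + ∑ xs g
  ∑-distrib-+ []       f g = ≈-sym (+-identityˡ 0#)
  ∑-distrib-+ (x ∷ xs) f g = begin
    (f x + g x) + ∑[ y ∈ xs ] (f y + g y)  ≈⟨ +-congˡ (∑-distrib-+ xs f g) ⟩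
    (f x + g x) + (∑ xs f + ∑ xs g)        ≈⟨ interchange (f x) (g x) _ _ ⟩
    (f x + ∑ xs f) + (g x + ∑ xs g)        ∎

  *-distribˡ-∑ : {A : Set} (a : Carrier) (xs : List A) (f : A → Carrier) → a * ∑ xs f ≈ ∑[ x ∈ xs ] (a * f x)
  *-distribˡ-∑ a []       f = zeroʳ a
  *-distribˡ-∑ a (x ∷ xs) f = ≈-trans (distribˡ a _ _) (+-congˡ (*-distribˡ-∑ a xs f))

  ∑-comm : {A B : Set} (xs : List A) (ys : List B) (f : A → B → Carrier) →
           ∑[ x ∈ xs ] ∑[ y ∈ ys ] f x y ≈ ∑[ y ∈ ys ] ∑[ x ∈ xs ] f x y
  ∑-comm []       ys f = ≈-sym (∑-0# ys)
  ∑-comm (x ∷ xs) ys f = ≈-trans (+-congˡ (∑-comm xs ys f)) (≈-sym (∑-distrib-+ ys (f x) _))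

  ∑-++ : {A : Set} (xs ys : List A) (f : A → Carrier) → ∑ (xs L.++ ys) f ≈ ∑ xs f + ∑ ys f
  ∑-++ []       ys f = ≈-sym (+-identityˡ _)
  ∑-++ (x ∷ xs) ys f = ≈-trans (+-congˡ (∑-++ xs ys f)) (≈-sym (+-assoc _ _ _))

  ∑-map : {A B : Set} (g : A → B) (xs : List A) (f : B → Carrier) → ∑ (map g xs) f ≡ ∑[ x ∈ xs ] f (g x)
  ∑-map g []       f = refl
  ∑-map g (x ∷ xs) f = cong (f (g x) +_) (∑-map g xs f)

  ∑-concatMap : {A B : Set} (h : A → List B) (xs : List A) (f : B → Carrier) →
                ∑ (L.concatMap h xs) f ≈ ∑[ x ∈ xs ] ∑ (h x) f
  ∑-concatMap h []       f = ≈-refl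
  ∑-concatMap h (x ∷ xs) f = ≈-trans (∑-++ (h x) _ f) (+-congˡ (∑-concatMap h xs f))

  ∑-filter : {A : Set} {P : A → Set} (P? : Decidable P) (xs : List A) (f : A → Carrier) →
             ∑ (L.filter P? xs) f ≈ ∑[ x ∈ xs ] [ does (P? x) ]? (f x)
  ∑-filter P? []       f = ≈-refl
  ∑-filter P? (x ∷ xs) f with does (P? x)
  ... | true  = +-congˡ (∑-filter P? xs f)
  ... | false = ≈-trans (∑-filter P? xs f) (≈-sym (+-identityˡ _))

  ∑-allFin-suc : (m : ℕ) (f : Fin (suc m) → Carrier) → ∑ (allFin (suc m)) f ≈ f zero + ∑[ i ∈ allFin m ] f (suc i)
  ∑-allFin-suc m f = +-congˡ (reflexive (trans (cong (λ is → ∑ is f) (sym (LP.map-tabulate (λ i → i) suc)))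
                                                (∑-map suc (allFin m) f)))

  []?-0# : ∀ b → [ b ]? 0# ≈ 0#
  []?-0# true  = ≈-refl
  []?-0# false = ≈-refl

  []?-*ʳ : ∀ b x y → x * [ b ]? y ≈ [ b ]? (x * y)
  []?-*ʳ true  x y = ≈-refl
  []?-*ʳ false x y = zeroʳ x

  []?-∧ : ∀ a b x → [ a ∧ b ]? x ≡ [ a ]? ([ b ]? x)
  []?-∧ true  b x = refl
  []?-∧ false b x = refl

  []?-comm : ∀ a b x → [ a ]? ([ b ]? x) ≡ [ b ]? ([ a ]? x)
  []?-comm true  b     x = refl
  []?-comm false true  x = refl
  []?-comm false false x = refl

  []?-cong : ∀ b {x y} → (b ≡ true → x ≈ y) → [ b ]? x ≈ [ b ]? y
  []?-cong true  e = e refl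
  []?-cong false e = ≈-refl

  []?-+ : ∀ b x y → [ b ]? (x + y) ≈ [ b ]? x + [ b ]? y
  []?-+ true  x y = ≈-refl
  []?-+ false x y = ≈-sym (+-identityˡ 0#)

  []?-∑ : {A : Set} (b : Bool) (xs : List A) (f : A → Carrier) → [ b ]? (∑ xs f) ≈ ∑[ x ∈ xs ] [ b ]? (f x)
  []?-∑ true  xs f = ≈-refl
  []?-∑ false xs f = ≈-sym (∑-0# xs)

  []?-false : ∀ b {x} → b ≢ true → [ b ]? x ≈ 0#
  []?-false true  b≢true = ⊥-elim (b≢true refl)
  []?-false false b≢true = ≈-refl

  ∑-allFin-single : (m : ℕ) (r : Fin m) (b : Fin m → Bool) (h : Fin m → Carrier) →
                    b r ≡ true → (∀ i → b i ≡ true → i ≡ r) → ∑[ i ∈ allFin m ] [ b i ]? (h i) ≈ h r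
  ∑-allFin-single (suc m) zero b h b-r b-only = begin
    ∑[ i ∈ allFin (suc m) ] [ b i ]? (h i)
      ≈⟨ ∑-allFin-suc m _ ⟩
    [ b zero ]? (h zero) + ∑[ i ∈ allFin m ] [ b (suc i) ]? (h (suc i))
      ≈⟨ +-cong (reflexive (cong (λ x → [ x ]? (h zero)) b-r))
                (≈-trans (∑-cong (allFin m) λ i → []?-false (b (suc i)) (λ e → FP.0≢1+n (sym (b-only (suc i) e))))
                         (∑-0# (allFin m))) ⟩
    h zero + 0#  ≈⟨ +-identityʳ _ ⟩
    h zero       ∎
  ∑-allFin-single (suc m) (suc r) b h b-r b-only = begin
    ∑[ i ∈ allFin (suc m) ] [ b i ]? (h i)
      ≈⟨ ∑-allFin-suc m _ ⟩
    [ b zero ]? (h zero) + ∑[ i ∈ allFin m ] [ b (suc i) ]? (h (suc i))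
      ≈⟨ +-cong ([]?-false (b zero) (λ e → FP.0≢1+n (b-only zero e)))
                (∑-allFin-single m r (b ∘ suc) (h ∘ suc) b-r (λ i e → FP.suc-injective (b-only (suc i) e))) ⟩
    0# + h (suc r)  ≈⟨ +-identityˡ _ ⟩
    h (suc r)       ∎

  ∑-upTo-suc : (m : ℕ) (f : ℕ → Carrier) → ∑ (upTo (suc m)) f ≡ f 0 + ∑[ j ∈ upTo m ] f (suc j)
  ∑-upTo-suc m f = cong (f 0 +_) (trans (cong (λ js → ∑ js f) (sym (LP.map-upTo suc m))) (∑-map suc (upTo m) f))

  ∑-upTo : (m : ℕ) (f : ℕ → Carrier) → ∑ (upTo m) f ≈ ∑[ i ∈ allFin m ] f (F.toℕ i)
  ∑-upTo zero    f = ≈-refl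
  ∑-upTo (suc m) f = begin
    ∑ (upTo (suc m)) f                         ≡⟨ ∑-upTo-suc m f ⟩
    f 0 + ∑[ j ∈ upTo m ] f (suc j)            ≈⟨ +-congˡ (∑-upTo m (f ∘ suc)) ⟩
    f 0 + ∑[ i ∈ allFin m ] f (suc (F.toℕ i))  ≈⟨ ∑-allFin-suc m _ ⟨
    ∑[ i ∈ allFin (suc m) ] f (F.toℕ i)        ∎

  ∑-upTo-∸ : (l a : ℕ) (h : ℕ → Carrier) → a ≤ l →
             ∑[ j ∈ upTo (suc l) ] [ does (a ℕ.≟ l ∸ j) ]? (h j) ≈ h (l ∸ a)
  ∑-upTo-∸ l a h a≤l = begin
    ∑[ j ∈ upTo (suc l) ] [ does (a ℕ.≟ l ∸ j) ]? (h j)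
      ≈⟨ ∑-upTo (suc l) _ ⟩
    ∑[ i ∈ allFin (suc l) ] [ does (a ℕ.≟ l ∸ F.toℕ i) ]? (h (F.toℕ i))
      ≈⟨ ∑-allFin-single (suc l) i₀ _ _ (dec-true (a ℕ.≟ l ∸ F.toℕ i₀) a≡l∸i₀) only-i₀ ⟩
    h (F.toℕ i₀)
      ≡⟨ cong h toℕ-i₀ ⟩
    h (l ∸ a) ∎
    where
    i₀ : Fin (suc l)
    i₀ = F.fromℕ< (ℕ.s≤s (NP.m∸n≤m l a))
    toℕ-i₀ : F.toℕ i₀ ≡ l ∸ a
    toℕ-i₀ = FP.toℕ-fromℕ< _
    a≡l∸i₀ : a ≡ l ∸ F.toℕ i₀
    a≡l∸i₀ = trans (sym (NP.m∸[m∸n]≡n a≤l)) (cong (l ∸_) (sym toℕ-i₀))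
    only-i₀ : ∀ i → does (a ℕ.≟ l ∸ F.toℕ i) ≡ true → i ≡ i₀
    only-i₀ i e = FP.toℕ-injective (trans (sym (NP.m∸[m∸n]≡n (NP.m<1+n⇒m≤n (FP.toℕ<n i))))
                                          (trans (cong (l ∸_) (sym (does-true⇒ (a ℕ.≟ l ∸ F.toℕ i) e))) (sym toℕ-i₀)))

  ∑-allSubsets-suc : (m : ℕ) (f : Subset (suc m) → Carrier) →
                     ∑ (allSubsets (suc m)) f ≈ ∑[ A ∈ allSubsets m ] f (outside ∷ A) + ∑[ A ∈ allSubsets m ] f (inside ∷ A)
  ∑-allSubsets-suc m f = begin
    ∑ (allSubsets (suc m)) f
      ≈⟨ ∑-concatMap (λ b → map (b ∷_) (allSubsets m)) (outside ∷ inside ∷ []) f ⟩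
    ∑ (map (outside ∷_) (allSubsets m)) f + (∑ (map (inside ∷_) (allSubsets m)) f + 0#)
      ≈⟨ +-cong (reflexive (∑-map _ (allSubsets m) f)) (≈-trans (+-identityʳ _) (reflexive (∑-map _ (allSubsets m) f))) ⟩
    ∑[ A ∈ allSubsets m ] f (outside ∷ A) + ∑[ A ∈ allSubsets m ] f (inside ∷ A) ∎

  ∑-allSubsets-⁅⁆∪ : (m : ℕ) (r : Fin m) (f : Subset m → Carrier) →
                     ∑ (allSubsets m) f ≈ ∑[ A ∈ allSubsets m ] [ not (lookup A r) ]? (f A)
                                          + ∑[ A ∈ allSubsets m ] [ not (lookup A r) ]? (f (⁅ r ⁆ ∪ A))
  ∑-allSubsets-⁅⁆∪ (suc m) zero f = begin
    ∑ (allSubsets (suc m)) f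
      ≈⟨ ∑-allSubsets-suc m f ⟩
    ∑[ A ∈ allSubsets m ] f (outside ∷ A) + ∑[ A ∈ allSubsets m ] f (inside ∷ A)
      ≈⟨ +-congˡ (∑-cong (allSubsets m) λ A → reflexive (cong (λ B → f (inside ∷ B)) (sym (∪-identityˡ A)))) ⟩
    ∑[ A ∈ allSubsets m ] f (outside ∷ A) + ∑[ A ∈ allSubsets m ] f (⁅ zero ⁆ ∪ (outside ∷ A))
      ≈⟨ +-cong (≈-sym (plus-0# _)) (≈-sym (plus-0# _)) ⟩
    (∑[ A ∈ allSubsets m ] f (outside ∷ A) + ∑[ A ∈ allSubsets m ] 0#)
      + (∑[ A ∈ allSubsets m ] f (⁅ zero ⁆ ∪ (outside ∷ A)) + ∑[ A ∈ allSubsets m ] 0#)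
      ≈⟨ +-cong (∑-allSubsets-suc m _) (∑-allSubsets-suc m _) ⟨
    ∑[ A ∈ allSubsets (suc m) ] [ not (lookup A zero) ]? (f A)
      + ∑[ A ∈ allSubsets (suc m) ] [ not (lookup A zero) ]? (f (⁅ zero ⁆ ∪ A)) ∎
    where
    plus-0# : ∀ x → x + ∑[ A ∈ allSubsets m ] 0# ≈ x
    plus-0# x = ≈-trans (+-congˡ (∑-0# (allSubsets m))) (+-identityʳ x)
  ∑-allSubsets-⁅⁆∪ (suc m) (suc r) f = begin
    ∑ (allSubsets (suc m)) f
      ≈⟨ ∑-allSubsets-suc m f ⟩
    ∑[ A ∈ allSubsets m ] f (outside ∷ A) + ∑[ A ∈ allSubsets m ] f (inside ∷ A)
      ≈⟨ +-cong (∑-allSubsets-⁅⁆∪ m r (λ A → f (outside ∷ A))) (∑-allSubsets-⁅⁆∪ m r (λ A → f (inside ∷ A))) ⟩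
    _ ≈⟨ interchange _ _ _ _ ⟩
    _ ≈⟨ +-cong (∑-allSubsets-suc m _) (∑-allSubsets-suc m _) ⟨
    ∑[ A ∈ allSubsets (suc m) ] [ not (lookup A (suc r)) ]? (f A)
      + ∑[ A ∈ allSubsets (suc m) ] [ not (lookup A (suc r)) ]? (f (⁅ suc r ⁆ ∪ A)) ∎

  ∑-⊆ᵇ-empty : (m : ℕ) (E : Subset m) → (∀ i → lookup E i ≡ false) → (g : Subset m → Carrier) →
               ∑[ A ∈ allSubsets m ] [ A ⊆ᵇ E ]? (g A) ≈ g ⊥
  ∑-⊆ᵇ-empty zero    []            E-empty g = +-identityʳ _
  ∑-⊆ᵇ-empty (suc m) (outside ∷ E) E-empty g = begin
    ∑[ A ∈ allSubsets (suc m) ] [ A ⊆ᵇ (outside ∷ E) ]? (g A)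
      ≈⟨ ∑-allSubsets-suc m _ ⟩
    ∑[ A ∈ allSubsets m ] [ A ⊆ᵇ E ]? (g (outside ∷ A)) + ∑[ A ∈ allSubsets m ] 0#
      ≈⟨ +-cong (∑-⊆ᵇ-empty m E (E-empty ∘ suc) (g ∘ (outside ∷_))) (∑-0# (allSubsets m)) ⟩
    g ⊥ + 0#  ≈⟨ +-identityʳ _ ⟩
    g ⊥       ∎
  ∑-⊆ᵇ-empty (suc m) (inside ∷ E) E-empty g with () ← E-empty zero

  ∑-lookup-cast : (xs : List (Fin n)) (k : ℕ) (e : k ≡ length xs) (g : Fin n → Carrier) →
                  ∑[ j ∈ allFin k ] g (L.lookup xs (cast e j)) ≈ ∑ xs g
  ∑-lookup-cast []       zero    e g = ≈-refl
  ∑-lookup-cast (x ∷ xs) (suc k) e g =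
    ≈-trans (∑-allFin-suc k _) (+-congˡ (∑-lookup-cast xs k (NP.suc-injective e) g))

  ∑-elems : (C : Subset n) (g : Fin n → Carrier) → ∑ (elems C) g ≈ ∑[ c ∈ allFin n ] [ lookup C c ]? (g c)
  ∑-elems []                    g = ≈-refl
  ∑-elems {suc n} (outside ∷ C) g = begin
    ∑ (map suc (elems C)) g                                    ≡⟨ ∑-map suc (elems C) g ⟩
    ∑[ c ∈ elems C ] g (suc c)                                 ≈⟨ ∑-elems C (g ∘ suc) ⟩
    ∑[ c ∈ allFin n ] [ lookup C c ]? (g (suc c))              ≈⟨ +-identityˡ _ ⟨
    0# + ∑[ c ∈ allFin n ] [ lookup C c ]? (g (suc c))         ≈⟨ ∑-allFin-suc n _ ⟨
    ∑[ c ∈ allFin (suc n) ] [ lookup (outside ∷ C) c ]? (g c)  ∎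
  ∑-elems {suc n} (inside ∷ C) g = begin
    g zero + ∑ (map suc (elems C)) g                          ≡⟨ cong (g zero +_) (∑-map suc (elems C) g) ⟩
    g zero + ∑[ c ∈ elems C ] g (suc c)                       ≈⟨ +-congˡ (∑-elems C (g ∘ suc)) ⟩
    g zero + ∑[ c ∈ allFin n ] [ lookup C c ]? (g (suc c))    ≈⟨ ∑-allFin-suc n _ ⟨
    ∑[ c ∈ allFin (suc n) ] [ lookup (inside ∷ C) c ]? (g c)  ∎

  -- The sum over injections f from the rows rs into the columns D of Π Y r (f r):
  -- the permanent of the submatrix with rows rs and columns D when length rs = ∣ D ∣.
  perm : Matrix R n → List (Fin n) → Subset n → Carrier
  perm     Y []       D = 1#
  perm {n} Y (r ∷ rs) D = ∑[ c ∈ allFin n ] [ lookup D c ]? (Y r c * perm Y rs (D ─ ⁅ c ⁆))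

  module _ {n m : ℕ} (Y : Matrix R n) (κ : Fin m → Fin n) (κ-inj : Injective _≡_ _≡_ κ) where

    permVia : (k : ℕ) → (Fin k → Fin n) → Subset n → Carrier
    permVia k ρ D =
      ∑[ v ∈ allVecs k m ] [ uniqueᵇ (V.toList v) ∧ mapsInto D κ v ]? (ΠF R k (λ i → Y (ρ i) (κ (lookup v i))))

    permVia-suc : (k : ℕ) (ρ : Fin (suc k) → Fin n) (D : Subset n) →
                  permVia (suc k) ρ D
                  ≈ ∑[ j ∈ allFin m ] [ lookup D (κ j) ]? (Y (ρ zero) (κ j) * permVia k (ρ ∘ suc) (D ─ ⁅ κ j ⁆))
    permVia-suc k ρ D = begin
      permVia (suc k) ρ D
        ≈⟨ ∑-concatMap (λ i → map (i ∷_) (allVecs k m)) (allFin m) _ ⟩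
      ∑[ j ∈ allFin m ] ∑ (map (j ∷_) (allVecs k m)) summand
        ≈⟨ ∑-cong (allFin m) (λ j → reflexive (∑-map (j ∷_) (allVecs k m) summand)) ⟩
      ∑[ j ∈ allFin m ] ∑[ v ∈ allVecs k m ] summand (j ∷ v)
        ≈⟨ ∑-cong (allFin m) (λ j → ≈-sym (expand j)) ⟩
      ∑[ j ∈ allFin m ] [ lookup D (κ j) ]? (Y (ρ zero) (κ j) * permVia k (ρ ∘ suc) (D ─ ⁅ κ j ⁆)) ∎
      where
      summand : Vec (Fin m) (suc k) → Carrier
      summand v = [ uniqueᵇ (V.toList v) ∧ mapsInto D κ v ]? (ΠF R (suc k) (λ i → Y (ρ i) (κ (lookup v i))))
      tail : Vec (Fin m) k → Carrier
      tail v = ΠF R k (λ i → Y (ρ (suc i)) (κ (lookup v i)))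
      expand : ∀ j → [ lookup D (κ j) ]? (Y (ρ zero) (κ j) * permVia k (ρ ∘ suc) (D ─ ⁅ κ j ⁆))
                     ≈ ∑[ v ∈ allVecs k m ] summand (j ∷ v)
      expand j = begin
        [ d ]? (Y (ρ zero) (κ j) * permVia k (ρ ∘ suc) (D ─ ⁅ κ j ⁆))
          ≈⟨ []?-cong d (λ _ → *-distribˡ-∑ _ (allVecs k m) _) ⟩
        [ d ]? (∑[ v ∈ allVecs k m ] (Y (ρ zero) (κ j) * [ b v ]? (tail v)))
          ≈⟨ []?-∑ d (allVecs k m) _ ⟩
        ∑[ v ∈ allVecs k m ] [ d ]? (Y (ρ zero) (κ j) * [ b v ]? (tail v))
          ≈⟨ ∑-cong (allVecs k m) (λ v → []?-cong d (λ _ → []?-*ʳ (b v) _ _)) ⟩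
        ∑[ v ∈ allVecs k m ] [ d ]? ([ b v ]? (Y (ρ zero) (κ j) * tail v))
          ≈⟨ ∑-cong (allVecs k m) (λ v → reflexive (merge v)) ⟩
        ∑[ v ∈ allVecs k m ] summand (j ∷ v) ∎
        where
        open ∨-∧-Solver
        d = lookup D (κ j)
        b : Vec (Fin m) k → Bool
        b v = uniqueᵇ (V.toList v) ∧ mapsInto (D ─ ⁅ κ j ⁆) κ v
        rearrange : ∀ w x y z → (w ∧ x) ∧ (y ∧ z) ≡ y ∧ (x ∧ (z ∧ w))
        rearrange = solve 4 (λ w x y z → (w :* x) :* (y :* z) := y :* (x :* (z :* w))) refl
        guard-eq : ∀ v → d ∧ b v ≡ uniqueᵇ (j ∷ V.toList v) ∧ (d ∧ mapsInto D κ v)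
        guard-eq v = sym (trans (cong (_∧ (d ∧ mapsInto D κ v)) (uniqueᵇ-∷ j (V.toList v)))
                         (trans (rearrange (not (j ∈ᵇ V.toList v)) (uniqueᵇ (V.toList v)) d (mapsInto D κ v))
                                (cong (λ z → d ∧ (uniqueᵇ (V.toList v) ∧ z)) (sym (mapsInto-─⁅⁆ D κ κ-inj j v)))))
        merge : ∀ v → [ d ]? ([ b v ]? (Y (ρ zero) (κ j) * tail v)) ≡ summand (j ∷ v)
        merge v = trans (sym ([]?-∧ d (b v) _)) (cong (λ z → [ z ]? (Y (ρ zero) (κ j) * tail v)) (guard-eq v))

    permVia≈perm : (C : Subset n) →
                   (∀ g → ∑[ j ∈ allFin m ] g (κ j) ≈ ∑[ c ∈ allFin n ] [ lookup C c ]? (g c)) →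
                   (k : ℕ) (ρ : Fin k → Fin n) (D : Subset n) → (∀ x → lookup D x ≡ true → lookup C x ≡ true) →
                   permVia k ρ D ≈ perm Y (tabulate ρ) D
    permVia≈perm C κ-enum zero    ρ D D⊆C = +-identityʳ _
    permVia≈perm C κ-enum (suc k) ρ D D⊆C = begin
      permVia (suc k) ρ D
        ≈⟨ permVia-suc k ρ D ⟩
      ∑[ j ∈ allFin m ] [ lookup D (κ j) ]? (Y (ρ zero) (κ j) * permVia k (ρ ∘ suc) (D ─ ⁅ κ j ⁆))
        ≈⟨ ∑-cong (allFin m) (λ j → []?-cong (lookup D (κ j)) λ _ →
             *-congˡ (permVia≈perm C κ-enum k (ρ ∘ suc) (D ─ ⁅ κ j ⁆) (D─⁅⁆⊆C (κ j)))) ⟩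
      ∑[ j ∈ allFin m ] G (κ j)                ≈⟨ κ-enum G ⟩
      ∑[ c ∈ allFin n ] [ lookup C c ]? (G c)  ≈⟨ ∑-cong (allFin n) C-redundant ⟩
      ∑[ c ∈ allFin n ] G c                    ∎
      where
      G : Fin n → Carrier
      G c = [ lookup D c ]? (Y (ρ zero) c * perm Y (tabulate (ρ ∘ suc)) (D ─ ⁅ c ⁆))
      D─⁅⁆⊆C : ∀ c x → lookup (D ─ ⁅ c ⁆) x ≡ true → lookup C x ≡ true
      D─⁅⁆⊆C c x e = D⊆C x (proj₁ (∧-true⁻ (trans (sym (lookup-─ D ⁅ c ⁆ x)) e)))
      C-redundant : ∀ c → [ lookup C c ]? (G c) ≈ G c
      C-redundant c with lookup D c in D∋c
      ... | true  rewrite D⊆C c D∋c = ≈-refl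
      ... | false = []?-0# (lookup C c)

  zeon≈perm : (Y : Matrix R n) (k : ℕ) (B C : Subset n) → length (elems B) ≡ k → length (elems C) ≡ k →
              zeon R Y k B C ≈ perm Y (elems B) C
  zeon≈perm {n} Y k B C ∣B∣≡k ∣C∣≡k with length (elems B) ℕ.≟ k | length (elems C) ℕ.≟ k
  ... | no ∣B∣≢k | _         = ⊥-elim (∣B∣≢k ∣B∣≡k)
  ... | yes _    | no ∣C∣≢k  = ⊥-elim (∣C∣≢k ∣C∣≡k)
  ... | yes p    | yes q     = begin
    permanent R k (λ i j → Y (ρ i) (κ j))
      ≈⟨ ∑-filter (λ σ → UDS.unique? (FP.≡-decSetoid k) (V.toList σ)) (allVecs k k) _ ⟩
    ∑[ σ ∈ allVecs k k ] [ uniqueᵇ (V.toList σ) ]? (Π σ)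
      ≈⟨ ∑-cong (allVecs k k) (λ σ → reflexive (cong (λ b → [ b ]? (Π σ)) (all-in-C σ))) ⟩
    permVia Y κ κ-inj k ρ C
      ≈⟨ permVia≈perm Y κ κ-inj C κ-enum k ρ C (λ x e → e) ⟩
    perm Y (tabulate ρ) C
      ≡⟨ cong (λ rs → perm Y rs C) (tabulate-lookup-cast (elems B) k (sym p)) ⟩
    perm Y (elems B) C ∎
    where
    ρ κ : Fin k → Fin n
    ρ = L.lookup (elems B) ∘ cast (sym p)
    κ = L.lookup (elems C) ∘ cast (sym q)
    Π : Vec (Fin k) k → Carrier
    Π σ = ΠF R k (λ i → Y (ρ i) (κ (lookup σ i)))
    κ-inj : Injective _≡_ _≡_ κ
    κ-inj {a} {b} e = trans (sym (FP.cast-involutive q (sym q) a))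
                        (trans (cong (cast q) (lookup-injective (elems C) (Distinct-elems C) _ _ e))
                               (FP.cast-involutive q (sym q) b))
    κ-enum : ∀ g → ∑[ j ∈ allFin k ] g (κ j) ≈ ∑[ c ∈ allFin n ] [ lookup C c ]? (g c)
    κ-enum g = ≈-trans (∑-lookup-cast (elems C) k (sym q) g) (∑-elems C g)
    all-in-C : ∀ σ → uniqueᵇ (V.toList σ) ≡ uniqueᵇ (V.toList σ) ∧ mapsInto C κ σ
    all-in-C σ = sym (trans (cong (uniqueᵇ (V.toList σ) ∧_) (mapsInto-true C κ (λ j → lookup-elems C _) σ))
                            (∧-identityʳ _))

  row-sI+tX : {n : ℕ} (s t : Carrier) (X : Matrix R n) (r : Fin n) (D : Subset n) (F : Subset n → Carrier) →
              ∑[ c ∈ allFin n ] [ lookup D c ]? (sI+tX R s t X r c * F (D ─ ⁅ c ⁆))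
              ≈ s * [ lookup D r ]? (F (D ─ ⁅ r ⁆)) + t * ∑[ c ∈ allFin n ] [ lookup D c ]? (X r c * F (D ─ ⁅ c ⁆))
  row-sI+tX {n} s t X r D F = begin
    ∑[ c ∈ allFin n ] [ lookup D c ]? ((s * idM R r c + t * X r c) * F (D ─ ⁅ c ⁆))
      ≈⟨ ∑-cong (allFin n) split ⟩
    ∑[ c ∈ allFin n ] (s * [ r == c ]? ([ lookup D c ]? (F (D ─ ⁅ c ⁆))) + t * [ lookup D c ]? (X r c * F (D ─ ⁅ c ⁆)))
      ≈⟨ ∑-distrib-+ (allFin n) _ _ ⟩
    ∑[ c ∈ allFin n ] (s * [ r == c ]? ([ lookup D c ]? (F (D ─ ⁅ c ⁆))))
      + ∑[ c ∈ allFin n ] (t * [ lookup D c ]? (X r c * F (D ─ ⁅ c ⁆)))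
      ≈⟨ +-cong (*-distribˡ-∑ s (allFin n) _) (*-distribˡ-∑ t (allFin n) _) ⟨
    s * ∑[ c ∈ allFin n ] [ r == c ]? ([ lookup D c ]? (F (D ─ ⁅ c ⁆)))
      + t * ∑[ c ∈ allFin n ] [ lookup D c ]? (X r c * F (D ─ ⁅ c ⁆))
      ≈⟨ +-congʳ (*-congˡ (∑-allFin-single n r (r ==_) _ (==-refl r) (λ c e → sym (==⇒≡ e)))) ⟩
    s * [ lookup D r ]? (F (D ─ ⁅ r ⁆)) + t * ∑[ c ∈ allFin n ] [ lookup D c ]? (X r c * F (D ─ ⁅ c ⁆)) ∎
    where
    idM-* : ∀ c x → idM R r c * x ≈ [ r == c ]? x
    idM-* c x with r F.≟ c
    ... | yes _ = *-identityˡ x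
    ... | no  _ = zeroˡ x
    split : ∀ c → [ lookup D c ]? ((s * idM R r c + t * X r c) * F (D ─ ⁅ c ⁆))
                  ≈ s * [ r == c ]? ([ lookup D c ]? (F (D ─ ⁅ c ⁆))) + t * [ lookup D c ]? (X r c * F (D ─ ⁅ c ⁆))
    split c = begin
      [ lookup D c ]? ((s * idM R r c + t * X r c) * F (D ─ ⁅ c ⁆))
        ≈⟨ []?-cong (lookup D c) (λ _ → ≈-trans (distribʳ _ _ _) (+-cong (*-assoc _ _ _) (*-assoc _ _ _))) ⟩
      [ lookup D c ]? (s * (idM R r c * F (D ─ ⁅ c ⁆)) + t * (X r c * F (D ─ ⁅ c ⁆)))
        ≈⟨ []?-+ (lookup D c) _ _ ⟩
      [ lookup D c ]? (s * (idM R r c * F (D ─ ⁅ c ⁆))) + [ lookup D c ]? (t * (X r c * F (D ─ ⁅ c ⁆)))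
        ≈⟨ +-cong (≈-sym ([]?-*ʳ (lookup D c) s _)) (≈-sym ([]?-*ʳ (lookup D c) t _)) ⟩
      s * [ lookup D c ]? (idM R r c * F (D ─ ⁅ c ⁆)) + t * [ lookup D c ]? (X r c * F (D ─ ⁅ c ⁆))
        ≈⟨ +-congʳ (*-congˡ ([]?-cong (lookup D c) λ _ → idM-* c _)) ⟩
      s * [ lookup D c ]? ([ r == c ]? (F (D ─ ⁅ c ⁆))) + t * [ lookup D c ]? (X r c * F (D ─ ⁅ c ⁆))
        ≈⟨ +-congʳ (*-congˡ (reflexive ([]?-comm (lookup D c) (r == c) _))) ⟩
      s * [ r == c ]? ([ lookup D c ]? (F (D ─ ⁅ c ⁆))) + t * [ lookup D c ]? (X r c * F (D ─ ⁅ c ⁆)) ∎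

  []?-*-[]? : ∀ a b u x y → u * [ a ]? (x * [ b ]? y) ≈ [ a ∧ b ]? (u * (x * y))
  []?-*-[]? true  true  u x y = ≈-refl
  []?-*-[]? true  false u x y = ≈-trans (*-congˡ (zeroʳ x)) (zeroʳ u)
  []?-*-[]? false b     u x y = zeroʳ u

  module Expansion (s t : Carrier) {n : ℕ} (X : Matrix R n) where

    -- A is the set of rows that take the diagonal part s·δ(r,c) of (sI + tX) r c.
    term : List (Fin n) → Subset n → Subset n → Carrier
    term rs D A = pow R s ∣ A ∣ * (pow R t (length (remove A rs)) * perm X (remove A rs) (D ─ A))

    expansion : List (Fin n) → Subset n → Carrier
    expansion rs D = ∑[ A ∈ allSubsets n ] [ admissible rs D A ]? (term rs D A)

    term-⁅⁆∪ : (r : Fin n) (rs : List (Fin n)) → (r ∈ᵇ rs) ≡ false → (D A : Subset n) → lookup A r ≡ false →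
               term (r ∷ rs) D (⁅ r ⁆ ∪ A) ≈ s * term rs (D ─ ⁅ r ⁆) A
    term-⁅⁆∪ r rs r∉rs D A A∌r
      rewrite ∣⁅⁆∪∣ r A A∌r | remove-⁅⁆∪ r rs A r∉rs | sym (p─q─r≡p─q∪r D ⁅ r ⁆ A) = *-assoc s _ _

    term-∷ : (r : Fin n) (rs : List (Fin n)) (D A : Subset n) → lookup A r ≡ false →
             term (r ∷ rs) D A ≈ ∑[ c ∈ allFin n ] [ lookup (D ─ A) c ]? (t * (X r c * term rs (D ─ ⁅ c ⁆) A))
    term-∷ r rs D A A∌r rewrite A∌r = begin
      sA * ((t * tL) * ∑[ c ∈ allFin n ] [ lookup (D ─ A) c ]? (X r c * P ((D ─ A) ─ ⁅ c ⁆)))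
        ≈⟨ *-assoc sA (t * tL) _ ⟨
      (sA * (t * tL)) * ∑[ c ∈ allFin n ] [ lookup (D ─ A) c ]? (X r c * P ((D ─ A) ─ ⁅ c ⁆))
        ≈⟨ *-distribˡ-∑ _ (allFin n) _ ⟩
      ∑[ c ∈ allFin n ] ((sA * (t * tL)) * [ lookup (D ─ A) c ]? (X r c * P ((D ─ A) ─ ⁅ c ⁆)))
        ≈⟨ ∑-cong (allFin n) (λ c → ≈-trans ([]?-*ʳ (lookup (D ─ A) c) _ _) ([]?-cong (lookup (D ─ A) c) λ _ →
             ≈-trans (rearrange sA t tL (X r c) _) (reflexive (cong (λ E → t * (X r c * (sA * (tL * P E))))
                                                                    (p─q─r≡p─r─q D A ⁅ c ⁆))))) ⟩
      ∑[ c ∈ allFin n ] [ lookup (D ─ A) c ]? (t * (X r c * term rs (D ─ ⁅ c ⁆) A)) ∎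
      where
      sA = pow R s ∣ A ∣
      tL = pow R t (length (remove A rs))
      P = perm X (remove A rs)
      rearrange : ∀ a b c x q → (a * (b * c)) * (x * q) ≈ b * (x * (a * (c * q)))
      rearrange a b c x q = begin
        (a * (b * c)) * (x * q)  ≈⟨ *-congʳ (x∙yz≈y∙xz a b c) ⟩
        (b * (a * c)) * (x * q)  ≈⟨ *-assoc b _ _ ⟩
        b * ((a * c) * (x * q))  ≈⟨ *-congˡ (x∙yz≈y∙xz (a * c) x q) ⟩
        b * (x * ((a * c) * q))  ≈⟨ *-congˡ (*-congˡ (*-assoc a c q)) ⟩
        b * (x * (a * (c * q)))  ∎

    module _ (r : Fin n) (rs : List (Fin n)) (r∉rs : (r ∈ᵇ rs) ≡ false) (D : Subset n) where

      expansion-fixed :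
        ∑[ A ∈ allSubsets n ] [ not (lookup A r) ]? ([ admissible (r ∷ rs) D (⁅ r ⁆ ∪ A) ]? (term (r ∷ rs) D (⁅ r ⁆ ∪ A)))
        ≈ s * [ lookup D r ]? (expansion rs (D ─ ⁅ r ⁆))
      expansion-fixed = ≈-sym (begin
        s * [ d ]? (expansion rs (D ─ ⁅ r ⁆))
          ≈⟨ *-congˡ ([]?-∑ d (allSubsets n) _) ⟩
        s * ∑[ A ∈ allSubsets n ] [ d ]? ([ admissible rs (D ─ ⁅ r ⁆) A ]? (term rs (D ─ ⁅ r ⁆) A))
          ≈⟨ *-distribˡ-∑ s (allSubsets n) _ ⟩
        ∑[ A ∈ allSubsets n ] (s * [ d ]? ([ admissible rs (D ─ ⁅ r ⁆) A ]? (term rs (D ─ ⁅ r ⁆) A)))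
          ≈⟨ ∑-cong (allSubsets n) per-A ⟩
        ∑[ A ∈ allSubsets n ] [ not (lookup A r) ]? ([ admissible (r ∷ rs) D (⁅ r ⁆ ∪ A) ]? (term (r ∷ rs) D (⁅ r ⁆ ∪ A))) ∎)
        where
        d = lookup D r
        per-A : ∀ A → s * [ d ]? ([ admissible rs (D ─ ⁅ r ⁆) A ]? (term rs (D ─ ⁅ r ⁆) A))
                      ≈ [ not (lookup A r) ]? ([ admissible (r ∷ rs) D (⁅ r ⁆ ∪ A) ]? (term (r ∷ rs) D (⁅ r ⁆ ∪ A)))
        per-A A = begin
          s * [ d ]? ([ admissible rs (D ─ ⁅ r ⁆) A ]? (term rs (D ─ ⁅ r ⁆) A))
            ≡⟨ cong (s *_) ([]?-∧ d _ _) ⟨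
          s * [ d ∧ admissible rs (D ─ ⁅ r ⁆) A ]? (term rs (D ─ ⁅ r ⁆) A)
            ≈⟨ []?-*ʳ (d ∧ admissible rs (D ─ ⁅ r ⁆) A) s _ ⟩
          [ d ∧ admissible rs (D ─ ⁅ r ⁆) A ]? (s * term rs (D ─ ⁅ r ⁆) A)
            ≡⟨ cong (λ b → [ b ]? (s * term rs (D ─ ⁅ r ⁆) A)) (admissible-insert r rs D A) ⟨
          [ not (lookup A r) ∧ admissible (r ∷ rs) D (⁅ r ⁆ ∪ A) ]? (s * term rs (D ─ ⁅ r ⁆) A)
            ≈⟨ []?-cong _ (λ e → ≈-sym (term-⁅⁆∪ r rs r∉rs D A (not-injective (proj₁ (∧-true⁻ e))))) ⟩
          [ not (lookup A r) ∧ admissible (r ∷ rs) D (⁅ r ⁆ ∪ A) ]? (term (r ∷ rs) D (⁅ r ⁆ ∪ A))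
            ≡⟨ []?-∧ (not (lookup A r)) _ _ ⟩
          [ not (lookup A r) ]? ([ admissible (r ∷ rs) D (⁅ r ⁆ ∪ A) ]? (term (r ∷ rs) D (⁅ r ⁆ ∪ A))) ∎

      expansion-skip :
        ∑[ A ∈ allSubsets n ] [ not (lookup A r) ]? ([ admissible (r ∷ rs) D A ]? (term (r ∷ rs) D A))
        ≈ t * ∑[ c ∈ allFin n ] [ lookup D c ]? (X r c * expansion rs (D ─ ⁅ c ⁆))
      expansion-skip = begin
        ∑[ A ∈ allSubsets n ] [ not (lookup A r) ]? ([ admissible (r ∷ rs) D A ]? (term (r ∷ rs) D A))
          ≈⟨ ∑-cong (allSubsets n) (λ A → ≈-trans (per-A A) (∑-cong (allFin n) λ c →
               reflexive (cong (λ b → [ b ]? (summand A c)) (admissible-skip r rs r∉rs D A c)))) ⟩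
        ∑[ A ∈ allSubsets n ] ∑[ c ∈ allFin n ] [ lookup D c ∧ admissible rs (D ─ ⁅ c ⁆) A ]? (summand A c)
          ≈⟨ ∑-comm (allSubsets n) (allFin n) _ ⟩
        ∑[ c ∈ allFin n ] ∑[ A ∈ allSubsets n ] [ lookup D c ∧ admissible rs (D ─ ⁅ c ⁆) A ]? (summand A c)
          ≈⟨ ∑-cong (allFin n) per-c ⟨
        ∑[ c ∈ allFin n ] (t * [ lookup D c ]? (X r c * expansion rs (D ─ ⁅ c ⁆)))
          ≈⟨ *-distribˡ-∑ t (allFin n) _ ⟨
        t * ∑[ c ∈ allFin n ] [ lookup D c ]? (X r c * expansion rs (D ─ ⁅ c ⁆)) ∎
        where
        summand : Subset n → Fin n → Carrier
        summand A c = t * (X r c * term rs (D ─ ⁅ c ⁆) A)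
        per-A : ∀ A → [ not (lookup A r) ]? ([ admissible (r ∷ rs) D A ]? (term (r ∷ rs) D A))
                      ≈ ∑[ c ∈ allFin n ] [ not (lookup A r) ∧ (admissible (r ∷ rs) D A ∧ lookup (D ─ A) c) ]? (summand A c)
        per-A A = begin
          [ a∌r ]? ([ adm ]? (term (r ∷ rs) D A))
            ≈⟨ []?-cong a∌r (λ e → fixed-free (not-injective e)) ⟩
          [ a∌r ]? (∑[ c ∈ allFin n ] [ adm ∧ lookup (D ─ A) c ]? (summand A c))
            ≈⟨ []?-∑ a∌r (allFin n) _ ⟩
          ∑[ c ∈ allFin n ] [ a∌r ]? ([ adm ∧ lookup (D ─ A) c ]? (summand A c))
            ≈⟨ ∑-cong (allFin n) (λ c → reflexive (sym ([]?-∧ a∌r (adm ∧ lookup (D ─ A) c) _))) ⟩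
          ∑[ c ∈ allFin n ] [ a∌r ∧ (adm ∧ lookup (D ─ A) c) ]? (summand A c) ∎
          where
          a∌r = not (lookup A r)
          adm = admissible (r ∷ rs) D A
          fixed-free : lookup A r ≡ false →
                       [ adm ]? (term (r ∷ rs) D A) ≈ ∑[ c ∈ allFin n ] [ adm ∧ lookup (D ─ A) c ]? (summand A c)
          fixed-free A∌r = begin
            [ adm ]? (term (r ∷ rs) D A)
              ≈⟨ []?-cong adm (λ _ → term-∷ r rs D A A∌r) ⟩
            [ adm ]? (∑[ c ∈ allFin n ] [ lookup (D ─ A) c ]? (summand A c))
              ≈⟨ []?-∑ adm (allFin n) _ ⟩
            ∑[ c ∈ allFin n ] [ adm ]? ([ lookup (D ─ A) c ]? (summand A c))
              ≈⟨ ∑-cong (allFin n) (λ c → reflexive (sym ([]?-∧ adm (lookup (D ─ A) c) _))) ⟩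
            ∑[ c ∈ allFin n ] [ adm ∧ lookup (D ─ A) c ]? (summand A c) ∎
        per-c : ∀ c → t * [ lookup D c ]? (X r c * expansion rs (D ─ ⁅ c ⁆))
                      ≈ ∑[ A ∈ allSubsets n ] [ lookup D c ∧ admissible rs (D ─ ⁅ c ⁆) A ]? (summand A c)
        per-c c = begin
          t * [ lookup D c ]? (X r c * expansion rs (D ─ ⁅ c ⁆))
            ≈⟨ *-congˡ ([]?-cong (lookup D c) λ _ → *-distribˡ-∑ (X r c) (allSubsets n) _) ⟩
          t * [ lookup D c ]? (∑[ A ∈ allSubsets n ] (X r c * [ admissible rs (D ─ ⁅ c ⁆) A ]? (term rs (D ─ ⁅ c ⁆) A)))
            ≈⟨ *-congˡ ([]?-∑ (lookup D c) (allSubsets n) _) ⟩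
          t * ∑[ A ∈ allSubsets n ] [ lookup D c ]? (X r c * [ admissible rs (D ─ ⁅ c ⁆) A ]? (term rs (D ─ ⁅ c ⁆) A))
            ≈⟨ *-distribˡ-∑ t (allSubsets n) _ ⟩
          ∑[ A ∈ allSubsets n ] (t * [ lookup D c ]? (X r c * [ admissible rs (D ─ ⁅ c ⁆) A ]? (term rs (D ─ ⁅ c ⁆) A)))
            ≈⟨ ∑-cong (allSubsets n) (λ A → []?-*-[]? (lookup D c) _ t (X r c) _) ⟩
          ∑[ A ∈ allSubsets n ] [ lookup D c ∧ admissible rs (D ─ ⁅ c ⁆) A ]? (summand A c) ∎

      expansion-∷ : expansion (r ∷ rs) D
                    ≈ s * [ lookup D r ]? (expansion rs (D ─ ⁅ r ⁆))
                      + t * ∑[ c ∈ allFin n ] [ lookup D c ]? (X r c * expansion rs (D ─ ⁅ c ⁆))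
      expansion-∷ = ≈-trans (∑-allSubsets-⁅⁆∪ n r _) (≈-trans (+-cong expansion-skip expansion-fixed) (+-comm _ _))

    perm-sI+tX : (rs : List (Fin n)) → Distinct rs → (D : Subset n) → perm (sI+tX R s t X) rs D ≈ expansion rs D
    perm-sI+tX [] _ D = ≈-sym (begin
      expansion [] D                 ≈⟨ ∑-⊆ᵇ-empty n (fromList [] ∩ D) (lookup-fromList-∩ [] D) (term [] D) ⟩
      pow R s ∣ ⊥ {n} ∣ * (1# * 1#)  ≡⟨ cong (λ k → pow R s k * (1# * 1#)) (∣⊥∣≡0 n) ⟩
      1# * (1# * 1#)                 ≈⟨ ≈-trans (*-identityˡ _) (*-identityˡ _) ⟩
      1#                             ∎)
    perm-sI+tX (r ∷ rs) (r∉rs , distinct) D = begin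
      perm (sI+tX R s t X) (r ∷ rs) D
        ≈⟨ row-sI+tX s t X r D (perm (sI+tX R s t X) rs) ⟩
      s * [ lookup D r ]? (perm (sI+tX R s t X) rs (D ─ ⁅ r ⁆))
        + t * ∑[ c ∈ allFin n ] [ lookup D c ]? (X r c * perm (sI+tX R s t X) rs (D ─ ⁅ c ⁆))
        ≈⟨ +-cong (*-congˡ ([]?-cong (lookup D r) λ _ → perm-sI+tX rs distinct _))
                  (*-congˡ (∑-cong (allFin n) λ c → []?-cong (lookup D c) λ _ → *-congˡ (perm-sI+tX rs distinct _))) ⟩
      s * [ lookup D r ]? (expansion rs (D ─ ⁅ r ⁆))
        + t * ∑[ c ∈ allFin n ] [ lookup D c ]? (X r c * expansion rs (D ─ ⁅ c ⁆))
        ≈⟨ expansion-∷ r rs r∉rs D ⟨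
      expansion (r ∷ rs) D ∎

    coefficient : ℕ → ℕ → Carrier
    coefficient l j = pow R s (l ∸ j) * pow R t j

    coefficient-sum : (l : ℕ) (S T A : Subset n) → ∣ S ∣ ≡ l → ∣ T ∣ ≡ l → (A ⊆ᵇ (S ∩ T)) ≡ true →
                      ∑[ j ∈ upTo (suc l) ] [ does (∣ A ∣ ℕ.≟ l ∸ j) ]? (coefficient l j * zeon R X j (S ─ A) (T ─ A))
                      ≈ term (elems S) T A
    coefficient-sum l S T A ∣S∣≡l ∣T∣≡l A⊆S∩T = begin
      ∑[ j ∈ upTo (suc l) ] [ does (a ℕ.≟ l ∸ j) ]? (coefficient l j * zeon R X j (S ─ A) (T ─ A))
        ≈⟨ ∑-upTo-∸ l a _ a≤l ⟩
      coefficient l (l ∸ a) * zeon R X (l ∸ a) (S ─ A) (T ─ A)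
        ≈⟨ *-congˡ (zeon≈perm X (l ∸ a) (S ─ A) (T ─ A) (length-─ S ∣S∣≡l A⊆S) (length-─ T ∣T∣≡l A⊆T)) ⟩
      (pow R s (l ∸ (l ∸ a)) * pow R t (l ∸ a)) * perm X (elems (S ─ A)) (T ─ A)
        ≡⟨ cong (λ k → (pow R s k * pow R t (l ∸ a)) * perm X (elems (S ─ A)) (T ─ A)) (NP.m∸[m∸n]≡n a≤l) ⟩
      (pow R s a * pow R t (l ∸ a)) * perm X (elems (S ─ A)) (T ─ A)
        ≈⟨ *-assoc _ _ _ ⟩
      pow R s a * (pow R t (l ∸ a) * perm X (elems (S ─ A)) (T ─ A))
        ≡⟨ term-elems ⟨
      term (elems S) T A ∎
      where
      a = ∣ A ∣
      A⊆S = proj₁ (⊆ᵇ-∩⁻ A S T A⊆S∩T)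
      A⊆T = proj₂ (⊆ᵇ-∩⁻ A S T A⊆S∩T)
      a≤l : a ≤ l
      a≤l = subst (a ≤_) ∣S∣≡l (p⊆q⇒∣p∣≤∣q∣ (does-true⇒ (A ⊆? S) A⊆S))
      length-─ : (Z : Subset n) → ∣ Z ∣ ≡ l → (A ⊆ᵇ Z) ≡ true → length (elems (Z ─ A)) ≡ l ∸ a
      length-─ Z ∣Z∣≡l A⊆Z = trans (length-elems (Z ─ A)) (∣─∣≡∸ Z A ∣Z∣≡l A⊆Z)
      term-elems : term (elems S) T A ≡ pow R s a * (pow R t (l ∸ a) * perm X (elems (S ─ A)) (T ─ A))
      term-elems rewrite remove-elems S A | length-─ S ∣S∣≡l A⊆S = refl

    rhs≈expansion : (l : ℕ) (S T : Subset n) → ∣ S ∣ ≡ l → ∣ T ∣ ≡ l → rhs R s t X l S T ≈ expansion (elems S) T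
    rhs≈expansion l S T ∣S∣≡l ∣T∣≡l = begin
      rhs R s t X l S T
        ≈⟨ ∑-cong (upTo (suc l)) (λ j → *-congˡ (∑-filter (P? j) (allSubsets n) (z j))) ⟩
      ∑[ j ∈ upTo (suc l) ] (coefficient l j * ∑[ A ∈ allSubsets n ] [ does (P? j A) ]? (z j A))
        ≈⟨ ∑-cong (upTo (suc l)) (λ j → ≈-trans (*-distribˡ-∑ _ (allSubsets n) _)
                                                (∑-cong (allSubsets n) λ A → []?-*ʳ (does (P? j A)) _ _)) ⟩
      ∑[ j ∈ upTo (suc l) ] ∑[ A ∈ allSubsets n ] [ does (P? j A) ]? (coefficient l j * z j A)
        ≈⟨ ∑-comm (upTo (suc l)) (allSubsets n) _ ⟩
      ∑[ A ∈ allSubsets n ] ∑[ j ∈ upTo (suc l) ] [ does (P? j A) ]? (coefficient l j * z j A)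
        ≈⟨ ∑-cong (allSubsets n) per-A ⟩
      expansion (elems S) T ∎
      where
      P? : (j : ℕ) (A : Subset n) → Dec ((A ⊆ (S ∩ T)) × (∣ A ∣ ≡ l ∸ j))
      P? j A = (A ⊆? (S ∩ T)) ×-dec (∣ A ∣ ℕ.≟ l ∸ j)
      z : ℕ → Subset n → Carrier
      z j A = zeon R X j (S ─ A) (T ─ A)
      per-A : ∀ A → ∑[ j ∈ upTo (suc l) ] [ does (P? j A) ]? (coefficient l j * z j A)
                    ≈ [ admissible (elems S) T A ]? (term (elems S) T A)
      per-A A = begin
        ∑[ j ∈ upTo (suc l) ] [ A⊆S∩T ∧ does (∣ A ∣ ℕ.≟ l ∸ j) ]? (coefficient l j * z j A)
          ≈⟨ ∑-cong (upTo (suc l)) (λ j → reflexive ([]?-∧ A⊆S∩T _ _)) ⟩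
        ∑[ j ∈ upTo (suc l) ] [ A⊆S∩T ]? ([ does (∣ A ∣ ℕ.≟ l ∸ j) ]? (coefficient l j * z j A))
          ≈⟨ []?-∑ A⊆S∩T (upTo (suc l)) _ ⟨
        [ A⊆S∩T ]? (∑[ j ∈ upTo (suc l) ] [ does (∣ A ∣ ℕ.≟ l ∸ j) ]? (coefficient l j * z j A))
          ≈⟨ []?-cong A⊆S∩T (coefficient-sum l S T A ∣S∣≡l ∣T∣≡l) ⟩
        [ A⊆S∩T ]? (term (elems S) T A)
          ≡⟨ cong (λ Z → [ A ⊆ᵇ (Z ∩ T) ]? (term (elems S) T A)) (fromList-elems S) ⟨
        [ admissible (elems S) T A ]? (term (elems S) T A) ∎
        where A⊆S∩T = A ⊆ᵇ (S ∩ T)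

theorem2p2 : {c ℓ : Level} (R : CommutativeRing c ℓ) (n : ℕ) → 1 ≤ n →
    (X : Matrix R n) (s t : CommutativeRing.Carrier R) →
    (l : ℕ) → l ≤ n → (S T : Subset n) → ∣ S ∣ ≡ l → ∣ T ∣ ≡ l →
    CommutativeRing._≈_ R (zeon R (sI+tX R s t X) l S T) (rhs R s t X l S T)
theorem2p2 R n _ X s t l _ S T ∣S∣≡l ∣T∣≡l = begin
  zeon R (sI+tX R s t X) l S T
    ≈⟨ zeon≈perm R (sI+tX R s t X) l S T (trans (length-elems S) ∣S∣≡l) (trans (length-elems T) ∣T∣≡l) ⟩
  perm R (sI+tX R s t X) (elems S) T
    ≈⟨ perm-sI+tX (elems S) (Distinct-elems S) T ⟩
  expansion (elems S) T
    ≈⟨ rhs≈expansion l S T ∣S∣≡l ∣T∣≡l ⟨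
  rhs R s t X l S T ∎
  where
  open CommutativeRing R using (setoid)
  open import Relation.Binary.Reasoning.Setoid setoid
  open Expansion R s t X
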